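{- Let $r\ge2$ and let $T_r$ be the transitive tournament on $r$ vertices. If $D$ is a $T_r$-free digraph on $n$ vertices, then \[ \max\Big\{\sum_{v\in V(D)}d^+_D(v)^2,\ \sum_{v\in V(D)}d^-_D(v)^2\Big\}\le\left(\frac{r-2}{r-1}\right)^2n^3. \]
   Context: A digraph has a vertex set and arcs that are ordered pairs of distinct vertices (both $(u,v),(v,u)$ allowed). $d^+_D(v)$ is the number of arcs $(v,u)\in A(D)$ and $d^-_D(v)$ is the number of arcs $(u,v)\in A(D)$. The transitive tournament $T_r$ has vertices $1,\dots,r$ and arcs $(i,j)$ for $i<j$. $D$ is $T_r$-free if it has no subdigraph isomorphic to $T_r$. -}

module Defs where

open import Data.Nat using (ℕ; _+_; _*_; _^_; _⊔_)
open import Data.Bool using (Bool; true; false; if_then_else_)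
open import Data.Fin using (Fin; _<_)
open import Data.List using (List; map; allFin)
open import Data.Nat.ListAction using (sum)
open import Data.Product using (Σ; _×_)
open import Relation.Binary.PropositionalEquality using (_≡_)
open import Relation.Nullary using (¬_)
open import Function.Definitions using (Injective)

-- A (loopless) digraph on vertex set Fin n: arc (u,v) present iff arc u v ≡ true.
-- Both (u,v) and (v,u) may be present; no loops.
record Digraph (n : ℕ) : Set where
  field
    arc     : Fin n → Fin n → Bool
    loopless : ∀ v → arc v v ≡ false
open Digraph public

Σv : ∀ {n} → (Fin n → ℕ) → ℕ
Σv {n} f = sum (map f (allFin n))

outdeg : ∀ {n} → Digraph n → Fin n → ℕ
outdeg D v = Σv (λ u → if arc D v u then 1 else 0)

indeg : ∀ {n} → Digraph n → Fin n → ℕ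
indeg D v = Σv (λ u → if arc D u v then 1 else 0)

-- D contains a subdigraph isomorphic to the transitive tournament T_r
-- (vertices 1..r, arcs (i,j) for i<j): an injective vertex map sending
-- every arc of T_r to an arc of D.
ContainsTT : ∀ {n} → (r : ℕ) → Digraph n → Set
ContainsTT {n} r D =
  Σ (Fin r → Fin n) λ f → Injective _≡_ _≡_ f × (∀ i j → i < j → arc D (f i) (f j) ≡ true)

TT-free : ∀ {n} → (r : ℕ) → Digraph n → Set
TT-free r D = ¬ ContainsTT r D

-- Write d⁻ for in-degrees. Double counting gives Σ_w d⁻(w)² = Σ_v Σ_{w ∈ N⁺(v)} d⁻(w). The
-- out-neighbourhood I of v spans a T_{r-1}-free digraph, so by the Turán-type bound
-- (r - 2)·e(I) ≤ (r - 3)·|I|² the inner sum is at most e(I) + |I|(n - |I|) ≤ n·|I| - |I|²/(r - 2).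
-- Summing over v, Cauchy–Schwarz (Σ_v d⁺(v))² ≤ n·Σ_v d⁺(v)² and the Turán-type bound for D itself,
-- Σ_v d⁺(v) ≤ (r - 2)/(r - 1)·n², give the bound for Σ_w d⁻(w)²; the bound for out-degrees is the
-- bound for in-degrees of the reversed digraph.
module Submission where

open import Defs
open import Data.Nat
open import Data.Nat.Properties
open import Data.Nat.Tactic.RingSolver using (solve-∀)
import Data.Nat.ListAction as List
open import Data.Bool using (Bool; true; false; if_then_else_; _∧_; not)
open import Data.Bool.Properties using (∧-commutativeMonoid; not-¬)
open import Data.Fin using (Fin; zero; suc; opposite)
import Data.Fin as Fin
open import Data.Fin.Properties using (opposite-prop; opposite-involutive; toℕ<n)
open import Data.List using (tabulate)
open import Data.List.Properties using (map-tabulate)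
open import Data.Product using (Σ; ∃-syntax; _×_; _,_; proj₁; proj₂)
open import Data.Sum using (_⊎_; inj₁; inj₂)
open import Function using (id; _∘_; flip)
open import Function.Definitions using (Injective)
open import Relation.Nullary using (¬_; yes; no; contradiction)
open import Relation.Binary.PropositionalEquality hiding (J)
open import Algebra.Bundles using (CommutativeMonoid)
open import Algebra.Properties.CommutativeSemigroup (CommutativeMonoid.commutativeSemigroup ∧-commutativeMonoid)
  using (xy∙z≈xz∙y)
open import Algebra.Properties.Semiring.Sum +-*-semiring
  using (sum; sum-syntax; sum-cong-≗; ∑-distrib-+; ∑-comm; *-distribˡ-sum; *-distribʳ-sum)

private variable n r : ℕ

private
  2mn≤m²+n²-ordered : ∀ {m n} → m ≤ n → 2 * (m * n) ≤ m * m + n * n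
  2mn≤m²+n²-ordered {m} m≤n with k , refl ← m≤n⇒∃[o]m+o≡n m≤n =
    subst (2 * (m * (m + k)) ≤_) (gap m k) (m≤m+n _ (k * k))
    where
    gap : ∀ m k → 2 * (m * (m + k)) + k * k ≡ m * m + (m + k) * (m + k)
    gap = solve-∀

2mn≤m²+n² : ∀ m n → 2 * (m * n) ≤ m * m + n * n
2mn≤m²+n² m n with ≤-total m n
... | inj₁ m≤n = 2mn≤m²+n²-ordered m≤n
... | inj₂ n≤m = subst₂ _≤_ (cong (2 *_) (*-comm n m)) (+-comm (n * n) (m * m))
                           (2mn≤m²+n²-ordered n≤m)

-- The slack is (k - (s + 1) j)², supplied by 2mn≤m²+n².
turán-step : ∀ s {A B k j} → suc s * B ≤ s * (k * k) → A ≤ B + k * j + j * k →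
             suc (suc s) * A ≤ suc s * ((k + j) * (k + j))
turán-step s {A} {B} {k} {j} hB hA =
  *-cancelˡ-≤ (suc s) (+-cancelʳ-≤ cross _ _ (begin
    suc s * (suc (suc s) * A) + cross
      ≤⟨ +-monoˡ-≤ cross (*-monoʳ-≤ (suc s) (*-monoʳ-≤ (suc (suc s)) hA)) ⟩
    suc s * (suc (suc s) * (B + k * j + j * k)) + cross
      ≡⟨ expand s B k j ⟩
    suc (suc s) * (suc s * B) + rest + cross
      ≤⟨ +-monoˡ-≤ cross (+-monoˡ-≤ rest (*-monoʳ-≤ (suc (suc s)) hB)) ⟩
    suc (suc s) * (s * (k * k)) + rest + cross
      ≤⟨ +-monoʳ-≤ (suc (suc s) * (s * (k * k)) + rest) (2mn≤m²+n² k (suc s * j)) ⟩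
    suc (suc s) * (s * (k * k)) + rest + (k * k + suc s * j * (suc s * j))
      ≡⟨ collect s k j ⟩
    suc s * (suc s * ((k + j) * (k + j))) + cross ∎))
  where
  open ≤-Reasoning
  cross = 2 * (k * (suc s * j))
  rest = suc (suc s) * (suc s * (k * j + j * k))
  expand : ∀ s B k j →
           suc s * (suc (suc s) * (B + k * j + j * k)) + 2 * (k * (suc s * j)) ≡
           suc (suc s) * (suc s * B) + suc (suc s) * (suc s * (k * j + j * k)) + 2 * (k * (suc s * j))
  expand = solve-∀
  collect : ∀ s k j →
            suc (suc s) * (s * (k * k)) + suc (suc s) * (suc s * (k * j + j * k))
              + (k * k + suc s * j * (suc s * j)) ≡
            suc s * (suc s * ((k + j) * (k + j))) + 2 * (k * (suc s * j))
  collect = solve-∀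

neighbourhood-step : ∀ t {B X k j} → X ≤ B + k * j → suc t * B ≤ t * (k * k) →
                     suc t * X + k * k ≤ suc t * (k + j) * k
neighbourhood-step t {B} {X} {k} {j} hX hB = begin
  suc t * X + k * k                     ≤⟨ +-monoˡ-≤ (k * k) (*-monoʳ-≤ (suc t) hX) ⟩
  suc t * (B + k * j) + k * k           ≡⟨ cong (_+ k * k) (*-distribˡ-+ (suc t) B (k * j)) ⟩
  suc t * B + suc t * (k * j) + k * k   ≤⟨ +-monoˡ-≤ (k * k) (+-monoˡ-≤ (suc t * (k * j)) hB) ⟩
  t * (k * k) + suc t * (k * j) + k * k ≡⟨ collect t k j ⟩
  suc t * (k + j) * k                   ∎
  where
  open ≤-Reasoning
  collect : ∀ t k j → t * (k * k) + suc t * (k * j) + k * k ≡ suc t * (k + j) * k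
  collect = solve-∀

-- (t + 1)·Q ≤ (t + 1)·n·e - e²/n, and the right-hand side is increasing in e up to its
-- maximum e = (t + 1)n²/2 ≥ (t + 1)n²/(t + 2); evaluate it at the upper bound of e.
square-sum-step : ∀ t {n Q q e} → suc t * Q + q ≤ suc t * n * e → e * e ≤ n * q →
                  suc (suc t) * e ≤ suc t * (n * n) →
                  suc (suc t) * suc (suc t) * Q ≤ suc t * suc t * (n * n * n)
square-sum-step t {zero} {Q} {q} {e} hQ _ _ = begin
  suc (suc t) * suc (suc t) * Q ≡⟨ cong (suc (suc t) * suc (suc t) *_) Q≡0 ⟩
  suc (suc t) * suc (suc t) * 0 ≡⟨ *-zeroʳ (suc (suc t) * suc (suc t)) ⟩
  0                             ≡⟨ *-zeroʳ (suc t * suc t) ⟨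
  suc t * suc t * 0             ∎
  where
  open ≤-Reasoning
  Q≡0 : Q ≡ 0
  Q≡0 = n≤0⇒n≡0 (begin
    Q                     ≤⟨ m≤n*m Q (suc t) ⟩
    suc t * Q             ≤⟨ m≤m+n (suc t * Q) q ⟩
    suc t * Q + q         ≤⟨ hQ ⟩
    suc t * 0 * e         ≡⟨ cong (_* e) (*-zeroʳ (suc t)) ⟩
    0                     ∎)
square-sum-step t {n@(suc _)} {Q} {q} {e} hQ he hx =
  *-cancelˡ-≤ (s * n) (+-cancelˡ-≤ (x * x) _ _ (begin
    x * x + s * n * (s′ * s′ * Q)             ≤⟨ +-monoˡ-≤ _ x²≤ ⟩
    s′ * s′ * (n * q) + s * n * (s′ * s′ * Q) ≡⟨ factor s n Q q ⟩
    s′ * s′ * n * (s * Q + q)                 ≤⟨ *-monoʳ-≤ (s′ * s′ * n) hQ ⟩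
    s′ * s′ * n * (s * n * e)                 ≡⟨ regroup s n e ⟩
    s′ * x * (s * (n * n))                    ≡⟨ cong (s′ * x *_) (m+[n∸m]≡n hx) ⟨
    s′ * x * (x + y)                          ≤⟨ gap t x y ⟩
    s * ((x + y) * (x + y)) + x * x           ≡⟨ cong (λ z → s * (z * z) + x * x) (m+[n∸m]≡n hx) ⟩
    s * (s * (n * n) * (s * (n * n))) + x * x ≡⟨ collect s n x ⟩
    x * x + s * n * (s * s * (n * n * n))     ∎))
  where
  open ≤-Reasoning
  s = suc t
  s′ = suc (suc t)
  x = s′ * e
  y = s * (n * n) ∸ x
  x²≤ : x * x ≤ s′ * s′ * (n * q)
  x²≤ = subst (_≤ s′ * s′ * (n * q)) (square s′ e) (*-monoʳ-≤ (s′ * s′) he)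
    where
    square : ∀ a b → a * a * (b * b) ≡ a * b * (a * b)
    square = solve-∀
  gap : ∀ t x y → suc (suc t) * x * (x + y) ≤ suc t * ((x + y) * (x + y)) + x * x
  gap t x y = subst (suc (suc t) * x * (x + y) ≤_) (expand t x y) (m≤m+n _ (t * x * y + suc t * y * y))
    where
    expand : ∀ t x y → suc (suc t) * x * (x + y) + (t * x * y + suc t * y * y) ≡
                       suc t * ((x + y) * (x + y)) + x * x
    expand = solve-∀
  factor : ∀ s n Q q → suc s * suc s * (n * q) + s * n * (suc s * suc s * Q) ≡
                       suc s * suc s * n * (s * Q + q)
  factor = solve-∀
  regroup : ∀ s n e → suc s * suc s * n * (s * n * e) ≡ suc s * (suc s * e) * (s * (n * n))
  regroup = solve-∀
  collect : ∀ s n x → s * (s * (n * n) * (s * (n * n))) + x * x ≡ x * x + s * n * (s * s * (n * n * n))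
  collect = solve-∀

Σv≡sum : (f : Fin n → ℕ) → Σv f ≡ sum f
Σv≡sum f = trans (cong List.sum (map-tabulate id f)) (sum-tabulate f)
  where
  sum-tabulate : ∀ {n} (f : Fin n → ℕ) → List.sum (tabulate f) ≡ sum f
  sum-tabulate {zero} f = refl
  sum-tabulate {suc n} f = cong (f zero +_) (sum-tabulate (f ∘ suc))

sum-mono-≤ : {f g : Fin n → ℕ} → (∀ i → f i ≤ g i) → sum f ≤ sum g
sum-mono-≤ {zero} f≤g = z≤n
sum-mono-≤ {suc n} f≤g = +-mono-≤ (f≤g zero) (sum-mono-≤ (f≤g ∘ suc))

sum-const : ∀ n c → ∑[ i < n ] c ≡ n * c
sum-const zero c = refl
sum-const (suc n) c = cong (c +_) (sum-const n c)

cauchy-schwarz : (k : Fin n → ℕ) → sum k * sum k ≤ n * ∑[ i < n ] (k i * k i)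
cauchy-schwarz {n} k = *-cancelˡ-≤ 2 (begin
  2 * (sum k * sum k)                            ≡⟨ cong (2 *_) product-as-double-sum ⟩
  2 * (∑[ i < n ] ∑[ j < n ] (k i * k j))       ≡⟨ double ⟩
  ∑[ i < n ] ∑[ j < n ] (2 * (k i * k j))
    ≤⟨ sum-mono-≤ (λ i → sum-mono-≤ (λ j → 2mn≤m²+n² (k i) (k j))) ⟩
  ∑[ i < n ] ∑[ j < n ] (k i * k i + k j * k j)  ≡⟨ sum-cong-≗ (λ i → inner (k i * k i)) ⟩
  ∑[ i < n ] (n * (k i * k i) + Q)               ≡⟨ ∑-distrib-+ (λ i → n * (k i * k i)) (λ _ → Q) ⟩
  ∑[ i < n ] (n * (k i * k i)) + ∑[ i < n ] Q
    ≡⟨ cong₂ _+_ (*-distribˡ-sum n (λ i → k i * k i)) (sym (sum-const n Q)) ⟨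
  n * Q + n * Q                                  ≡⟨ cong (n * Q +_) (+-identityʳ (n * Q)) ⟨
  2 * (n * Q)                                    ∎)
  where
  open ≤-Reasoning
  Q = ∑[ i < n ] (k i * k i)
  product-as-double-sum : sum k * sum k ≡ ∑[ i < n ] ∑[ j < n ] (k i * k j)
  product-as-double-sum = trans (*-distribʳ-sum (sum k) k) (sum-cong-≗ (λ i → *-distribˡ-sum (k i) k))
  double : 2 * (∑[ i < n ] ∑[ j < n ] (k i * k j)) ≡ ∑[ i < n ] ∑[ j < n ] (2 * (k i * k j))
  double = trans (*-distribˡ-sum 2 (λ i → ∑[ j < n ] (k i * k j)))
                 (sum-cong-≗ (λ i → *-distribˡ-sum 2 (λ j → k i * k j)))
  inner : ∀ a → ∑[ j < n ] (a + k j * k j) ≡ n * a + Q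
  inner a = trans (∑-distrib-+ (λ _ → a) (λ j → k j * k j)) (cong (_+ Q) (sum-const n a))

𝟙 : Bool → ℕ
𝟙 b = if b then 1 else 0

VertexSet : ℕ → Set
VertexSet n = Fin n → Bool

U : VertexSet n
U _ = true

_∩_ _∖_ : VertexSet n → VertexSet n → VertexSet n
(S ∩ T) v = S v ∧ T v
(S ∖ T) v = S v ∧ not (T v)

∣_∣ : VertexSet n → ℕ
∣_∣ {n} S = ∑[ v < n ] 𝟙 (S v)

sumOver : VertexSet n → (Fin n → ℕ) → ℕ
sumOver {n} S f = ∑[ v < n ] (𝟙 (S v) * f v)

syntax sumOver S (λ v → e) = ∑[ v ∈ S ] e

∧≡true⇒ : ∀ {p q} → p ∧ q ≡ true → p ≡ true × q ≡ true
∧≡true⇒ {true} q≡true = refl , q≡true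

𝟙-split : ∀ p q → 𝟙 p ≡ 𝟙 (p ∧ q) + 𝟙 (p ∧ not q)
𝟙-split true true = refl
𝟙-split true false = refl
𝟙-split false q = refl

∣∣-split : (S T : VertexSet n) → ∣ S ∣ ≡ ∣ S ∩ T ∣ + ∣ S ∖ T ∣
∣∣-split S T = trans (sum-cong-≗ (λ v → 𝟙-split (S v) (T v))) (∑-distrib-+ (𝟙 ∘ (S ∩ T)) (𝟙 ∘ (S ∖ T)))

∣∩∣≤ : (S T : VertexSet n) → ∣ S ∩ T ∣ ≤ ∣ S ∣
∣∩∣≤ S T = sum-mono-≤ (λ v → 𝟙-∧-≤ (S v) (T v))
  where
  𝟙-∧-≤ : ∀ p q → 𝟙 (p ∧ q) ≤ 𝟙 p
  𝟙-∧-≤ true true = ≤-refl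
  𝟙-∧-≤ true false = z≤n
  𝟙-∧-≤ false q = z≤n

∣∣-empty : (S : VertexSet n) → (∀ v → S v ≡ false) → ∣ S ∣ ≡ 0
∣∣-empty {n} S empty = trans (sum-cong-≗ (cong 𝟙 ∘ empty)) (trans (sum-const n 0) (*-zeroʳ n))

∣U∣ : ∣ U {n} ∣ ≡ n
∣U∣ {n} = trans (sum-const n 1) (*-identityʳ n)

sumOver-U : (f : Fin n → ℕ) → ∑[ v ∈ U ] f v ≡ sum f
sumOver-U f = sum-cong-≗ (*-identityˡ ∘ f)

sumOver-split : (S T : VertexSet n) (f : Fin n → ℕ) →
                ∑[ v ∈ S ] f v ≡ ∑[ v ∈ S ∩ T ] f v + ∑[ v ∈ S ∖ T ] f v
sumOver-split S T f =
  trans (sum-cong-≗ split) (∑-distrib-+ (λ v → 𝟙 ((S ∩ T) v) * f v) (λ v → 𝟙 ((S ∖ T) v) * f v))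
  where
  split : ∀ v → 𝟙 (S v) * f v ≡ 𝟙 ((S ∩ T) v) * f v + 𝟙 ((S ∖ T) v) * f v
  split v = trans (cong (_* f v) (𝟙-split (S v) (T v))) (*-distribʳ-+ (f v) (𝟙 ((S ∩ T) v)) (𝟙 ((S ∖ T) v)))

sumOver-+ : (S : VertexSet n) (f g : Fin n → ℕ) →
            ∑[ v ∈ S ] (f v + g v) ≡ ∑[ v ∈ S ] f v + ∑[ v ∈ S ] g v
sumOver-+ S f g =
  trans (sum-cong-≗ (λ v → *-distribˡ-+ (𝟙 (S v)) (f v) (g v)))
        (∑-distrib-+ (λ v → 𝟙 (S v) * f v) (λ v → 𝟙 (S v) * g v))

sumOver-const : (S : VertexSet n) (c : ℕ) → ∑[ v ∈ S ] c ≡ ∣ S ∣ * c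
sumOver-const S c = sym (*-distribʳ-sum c (𝟙 ∘ S))

sumOver-mono-≤ : (S : VertexSet n) {f g : Fin n → ℕ} → (∀ v → S v ≡ true → f v ≤ g v) →
                 ∑[ v ∈ S ] f v ≤ ∑[ v ∈ S ] g v
sumOver-mono-≤ S f≤g = sum-mono-≤ (λ v → guarded (S v) (f≤g v))
  where
  guarded : ∀ b {m n} → (b ≡ true → m ≤ n) → 𝟙 b * m ≤ 𝟙 b * n
  guarded true h = *-monoʳ-≤ 1 (h refl)
  guarded false h = z≤n

sumOver-≤ : (S : VertexSet n) {f : Fin n → ℕ} {c : ℕ} → (∀ v → S v ≡ true → f v ≤ c) →
            ∑[ v ∈ S ] f v ≤ ∣ S ∣ * c
sumOver-≤ S {c = c} f≤c = ≤-trans (sumOver-mono-≤ S f≤c) (≤-reflexive (sumOver-const S c))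

sumOver-zero : (S : VertexSet n) {f : Fin n → ℕ} → (∀ v → S v ≡ true → f v ≡ 0) → ∑[ v ∈ S ] f v ≡ 0
sumOver-zero S f≡0 =
  n≤0⇒n≡0 (≤-trans (sumOver-≤ S (λ v → ≤-reflexive ∘ f≡0 v)) (≤-reflexive (*-zeroʳ ∣ S ∣)))

argmax-on : (S : VertexSet n) (f : Fin n → ℕ) →
            (∀ v → S v ≡ false) ⊎ ∃[ u ] S u ≡ true × (∀ v → S v ≡ true → f v ≤ f u)
argmax-on {zero} S f = inj₁ λ ()
argmax-on {suc n} S f with argmax-on (S ∘ suc) (f ∘ suc) | S zero in S0
... | inj₁ empty | false = inj₁ λ { zero → S0 ; (suc v) → empty v }
... | inj₁ empty | true =
  inj₂ (zero , S0 , λ { zero _ → ≤-refl ; (suc v) Sv → contradiction (empty v) (not-¬ Sv) })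
... | inj₂ (u , Su , u-max) | false =
  inj₂ (suc u , Su , λ { zero S0′ → contradiction S0 (not-¬ S0′) ; (suc v) → u-max v })
... | inj₂ (u , Su , u-max) | true with f zero ≤? f (suc u)
...   | yes f0≤fu = inj₂ (suc u , Su , λ { zero _ → f0≤fu ; (suc v) → u-max v })
...   | no f0≰fu =
  inj₂ (zero , S0 , λ { zero _ → ≤-refl ; (suc v) Sv → ≤-trans (u-max v Sv) (<⇒≤ (≰⇒> f0≰fu)) })

reverse : Digraph n → Digraph n
reverse D = record { arc = flip (arc D) ; loopless = loopless D }

N⁺ : Digraph n → Fin n → VertexSet n
N⁺ = arc

outdegIn : Digraph n → VertexSet n → Fin n → ℕ
outdegIn D S v = ∣ S ∩ N⁺ D v ∣

indegIn : Digraph n → VertexSet n → Fin n → ℕ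
indegIn D = outdegIn (reverse D)

arcsIn : Digraph n → VertexSet n → ℕ
arcsIn D S = ∑[ v ∈ S ] outdegIn D S v

ContainsTT-in : ℕ → Digraph n → VertexSet n → Set
ContainsTT-in r D S = Σ (ContainsTT r D) λ (f , _) → ∀ i → S (f i) ≡ true

TT-free-in : ℕ → Digraph n → VertexSet n → Set
TT-free-in r D S = ¬ ContainsTT-in r D S

TT-free-in-1⇒empty : (D : Digraph n) (S : VertexSet n) → TT-free-in 1 D S → ∀ v → S v ≡ false
TT-free-in-1⇒empty D S fr v with S v in Sv
... | false = refl
... | true = contradiction (((λ _ → v) , (λ { {zero} {zero} _ → refl }) , λ { zero zero () }) , λ _ → Sv) fr

TT-free-in-∩N⁺ : (D : Digraph n) (S : VertexSet n) {u : Fin n} → TT-free-in (suc r) D S → S u ≡ true →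
                 TT-free-in r D (S ∩ N⁺ D u)
TT-free-in-∩N⁺ {n} {r} D S {u} fr Su ((f , f-inj , f-arcs) , f∈) = fr ((g , g-inj , g-arcs) , g∈)
  where
  g : Fin (suc r) → Fin n
  g zero = u
  g (suc i) = f i
  g∈ : ∀ i → S (g i) ≡ true
  g∈ zero = Su
  g∈ (suc i) = proj₁ (∧≡true⇒ (f∈ i))
  u→f : ∀ i → arc D u (f i) ≡ true
  u→f i = proj₂ (∧≡true⇒ (f∈ i))
  u≢f : ∀ i → u ≢ f i
  u≢f i u≡fi = not-¬ (trans (cong (arc D u) u≡fi) (u→f i)) (loopless D u)
  g-inj : Injective _≡_ _≡_ g
  g-inj {zero} {zero} _ = refl
  g-inj {zero} {suc j} u≡fj = contradiction u≡fj (u≢f j)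
  g-inj {suc i} {zero} fi≡u = contradiction (sym fi≡u) (u≢f i)
  g-inj {suc i} {suc j} fi≡fj = cong suc (f-inj fi≡fj)
  g-arcs : ∀ i j → i Fin.< j → arc D (g i) (g j) ≡ true
  g-arcs zero (suc j) _ = u→f j
  g-arcs (suc i) (suc j) (s≤s i<j) = f-arcs i j i<j

TT-free-in-2⇒outdegIn≡0 : (D : Digraph n) (S : VertexSet n) {v : Fin n} → TT-free-in 2 D S → S v ≡ true →
                          outdegIn D S v ≡ 0
TT-free-in-2⇒outdegIn≡0 D S fr Sv = ∣∣-empty _ (TT-free-in-1⇒empty D _ (TT-free-in-∩N⁺ D S fr Sv))

opposite-< : {i j : Fin r} → i Fin.< j → opposite j Fin.< opposite i
opposite-< {r} {i} {j} i<j =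
  subst₂ _<_ (sym (opposite-prop j)) (sym (opposite-prop i)) (∸-monoʳ-< {m = r} (s≤s i<j) (toℕ<n j))

reverse-ContainsTT : (D : Digraph n) → ContainsTT r (reverse D) → ContainsTT r D
reverse-ContainsTT D (f , f-inj , f-arcs) = f ∘ opposite , f∘opposite-inj , λ i j i<j → f-arcs _ _ (opposite-< i<j)
  where
  f∘opposite-inj : Injective _≡_ _≡_ (f ∘ opposite)
  f∘opposite-inj {i} {j} eq =
    trans (sym (opposite-involutive i)) (trans (cong opposite (f-inj eq)) (opposite-involutive j))

TT-free-in-reverse : (D : Digraph n) (S : VertexSet n) → TT-free-in r D S → TT-free-in r (reverse D) S
TT-free-in-reverse D S fr (c@(f , _) , f∈) = fr (reverse-ContainsTT D c , f∈ ∘ opposite)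

outdegIn-split : (D : Digraph n) (S T : VertexSet n) (v : Fin n) →
                 outdegIn D S v ≤ outdegIn D (S ∩ T) v + ∣ S ∖ T ∣
outdegIn-split D S T v = begin
  ∣ S ∩ N⁺ D v ∣                              ≡⟨ ∣∣-split (S ∩ N⁺ D v) T ⟩
  ∣ (S ∩ N⁺ D v) ∩ T ∣ + ∣ (S ∩ N⁺ D v) ∖ T ∣  ≡⟨ cong₂ _+_ (swap T) (swap (not ∘ T)) ⟩
  ∣ (S ∩ T) ∩ N⁺ D v ∣ + ∣ (S ∖ T) ∩ N⁺ D v ∣  ≤⟨ +-monoʳ-≤ _ (∣∩∣≤ (S ∖ T) (N⁺ D v)) ⟩
  ∣ (S ∩ T) ∩ N⁺ D v ∣ + ∣ S ∖ T ∣            ∎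
  where
  open ≤-Reasoning
  swap : ∀ T′ → ∣ (S ∩ N⁺ D v) ∩ T′ ∣ ≡ ∣ (S ∩ T′) ∩ N⁺ D v ∣
  swap T′ = sum-cong-≗ (λ w → cong 𝟙 (xy∙z≈xz∙y (S w) (arc D v w) (T′ w)))

∑outdegIn-∩≤ : (D : Digraph n) (S T : VertexSet n) →
               ∑[ v ∈ S ∩ T ] outdegIn D S v ≤ arcsIn D (S ∩ T) + ∣ S ∩ T ∣ * ∣ S ∖ T ∣
∑outdegIn-∩≤ D S T = begin
  ∑[ v ∈ S ∩ T ] outdegIn D S v
    ≤⟨ sumOver-mono-≤ (S ∩ T) (λ v _ → outdegIn-split D S T v) ⟩
  ∑[ v ∈ S ∩ T ] (outdegIn D (S ∩ T) v + ∣ S ∖ T ∣)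
    ≡⟨ sumOver-+ (S ∩ T) (outdegIn D (S ∩ T)) (λ _ → ∣ S ∖ T ∣) ⟩
  arcsIn D (S ∩ T) + ∑[ v ∈ S ∩ T ] ∣ S ∖ T ∣
    ≡⟨ cong (arcsIn D (S ∩ T) +_) (sumOver-const (S ∩ T) ∣ S ∖ T ∣) ⟩
  arcsIn D (S ∩ T) + ∣ S ∩ T ∣ * ∣ S ∖ T ∣ ∎
  where open ≤-Reasoning

-- Take u of maximum out-degree inside S, I = S ∩ N⁺(u) and J = S ∖ N⁺(u): I is T_{s+2}-free, and
-- every vertex of J, like u, sends at most |I| arcs into S.
turán : (D : Digraph n) (s : ℕ) (S : VertexSet n) → TT-free-in (2 + s) D S →
        suc s * arcsIn D S ≤ s * (∣ S ∣ * ∣ S ∣)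
turán D zero S fr = ≤-reflexive (cong (1 *_) (sumOver-zero S (λ v → TT-free-in-2⇒outdegIn≡0 D S fr)))
turán D (suc s) S fr with argmax-on S (outdegIn D S)
... | inj₁ empty = subst (_≤ suc s * (∣ S ∣ * ∣ S ∣)) (sym no-arcs) z≤n
  where
  no-arcs : suc (suc s) * arcsIn D S ≡ 0
  no-arcs = trans (cong (suc (suc s) *_) (sumOver-zero S (λ v Sv → contradiction (empty v) (not-¬ Sv))))
                  (*-zeroʳ (suc (suc s)))
... | inj₂ (u , Su , u-max) =
  subst (λ m → suc (suc s) * arcsIn D S ≤ suc s * (m * m)) (sym (∣∣-split S (N⁺ D u)))
        (turán-step s {k = ∣ I ∣} {j = ∣ J ∣} (turán D s I (TT-free-in-∩N⁺ D S fr Su)) arcs-split)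
  where
  I J : VertexSet _
  I = S ∩ N⁺ D u
  J = S ∖ N⁺ D u
  arcs-split : arcsIn D S ≤ arcsIn D I + ∣ I ∣ * ∣ J ∣ + ∣ J ∣ * ∣ I ∣
  arcs-split = begin
    arcsIn D S
      ≡⟨ sumOver-split S (N⁺ D u) (outdegIn D S) ⟩
    ∑[ v ∈ I ] outdegIn D S v + ∑[ v ∈ J ] outdegIn D S v
      ≤⟨ +-mono-≤ (∑outdegIn-∩≤ D S (N⁺ D u)) (sumOver-≤ J (λ v Jv → u-max v (proj₁ (∧≡true⇒ Jv)))) ⟩
    arcsIn D I + ∣ I ∣ * ∣ J ∣ + ∣ J ∣ * ∣ I ∣ ∎
    where open ≤-Reasoning

∑indegIn²-bound : (D : Digraph n) (t : ℕ) → TT-free-in (3 + t) D U →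
                  suc (suc t) * suc (suc t) * ∑[ w < n ] (indegIn D U w * indegIn D U w)
                    ≤ suc t * suc t * (n * n * n)
∑indegIn²-bound {n} D t fr =
  subst (λ Q → suc (suc t) * suc (suc t) * Q ≤ suc t * suc t * (n * n * n)) (sym double-count)
        (square-sum-step t {n} {sum X} summed-neighbourhood-step (cauchy-schwarz d⁺) global-turán)
  where
  d⁻ d⁺ X : Fin n → ℕ
  d⁻ = indegIn D U
  d⁺ = outdegIn D U
  X v = ∑[ w ∈ N⁺ D v ] d⁻ w
  double-count : ∑[ w < n ] (d⁻ w * d⁻ w) ≡ sum X
  double-count = trans (sum-cong-≗ (λ w → *-distribʳ-sum (d⁻ w) (λ v → 𝟙 (arc D v w))))
                       (∑-comm (λ w v → 𝟙 (arc D v w) * d⁻ w))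
  neighbourhood : ∀ v → suc t * X v + d⁺ v * d⁺ v ≤ suc t * n * d⁺ v
  neighbourhood v =
    subst (λ m → suc t * X v + d⁺ v * d⁺ v ≤ suc t * m * d⁺ v)
          (trans (sym (∣∣-split U (N⁺ D v))) (∣U∣ {n}))
          (neighbourhood-step t {k = d⁺ v} {j = ∣ U ∖ N⁺ D v ∣} (∑outdegIn-∩≤ (reverse D) U (N⁺ D v))
            (turán (reverse D) t (N⁺ D v) (TT-free-in-reverse D (N⁺ D v) (TT-free-in-∩N⁺ D U {v} fr refl))))
  summed-neighbourhood-step : suc t * sum X + ∑[ v < n ] (d⁺ v * d⁺ v) ≤ suc t * n * sum d⁺
  summed-neighbourhood-step = begin
    suc t * sum X + ∑[ v < n ] (d⁺ v * d⁺ v)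
      ≡⟨ cong (_+ ∑[ v < n ] (d⁺ v * d⁺ v)) (*-distribˡ-sum (suc t) X) ⟩
    ∑[ v < n ] (suc t * X v) + ∑[ v < n ] (d⁺ v * d⁺ v)
      ≡⟨ ∑-distrib-+ (λ v → suc t * X v) (λ v → d⁺ v * d⁺ v) ⟨
    ∑[ v < n ] (suc t * X v + d⁺ v * d⁺ v)
      ≤⟨ sum-mono-≤ neighbourhood ⟩
    ∑[ v < n ] (suc t * n * d⁺ v)
      ≡⟨ *-distribˡ-sum (suc t * n) d⁺ ⟨
    suc t * n * sum d⁺ ∎
    where open ≤-Reasoning
  global-turán : suc (suc t) * sum d⁺ ≤ suc t * (n * n)
  global-turán =
    subst₂ (λ a m → suc (suc t) * a ≤ suc t * (m * m)) (sumOver-U d⁺) (∣U∣ {n}) (turán D (suc t) U fr)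

^2≡* : ∀ m → m ^ 2 ≡ m * m
^2≡* m = cong (m *_) (*-identityʳ m)

^3≡* : ∀ m → m ^ 3 ≡ m * m * m
^3≡* m = trans (cong (m *_) (^2≡* m)) (sym (*-assoc m m m))

Σv-indeg²≡∑indegIn² : (D : Digraph n) → Σv (λ v → indeg D v ^ 2) ≡ ∑[ v < n ] (indegIn D U v * indegIn D U v)
Σv-indeg²≡∑indegIn² D = trans (Σv≡sum (λ v → indeg D v ^ 2)) (sum-cong-≗ indeg²≡)
  where
  indeg²≡ : ∀ v → indeg D v ^ 2 ≡ indegIn D U v * indegIn D U v
  indeg²≡ v = trans (^2≡* (indeg D v)) (cong (λ d → d * d) (Σv≡sum (λ u → 𝟙 (arc D u v))))

indeg-bound : (r : ℕ) (D : Digraph n) → 2 ≤ r → TT-free r D →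
              (r ∸ 1) ^ 2 * Σv (λ v → indeg D v ^ 2) ≤ (r ∸ 2) ^ 2 * n ^ 3
indeg-bound 1 D (s≤s ()) fr
indeg-bound {n} 2 D _ fr = ≤-reflexive (cong (1 ^ 2 *_) (trans (Σv-indeg²≡∑indegIn² D) no-arcs))
  where
  indegIn≡0 : ∀ v → indegIn D U v ≡ 0
  indegIn≡0 v = TT-free-in-2⇒outdegIn≡0 (reverse D) U (TT-free-in-reverse D U (fr ∘ proj₁)) refl
  no-arcs : ∑[ v < n ] (indegIn D U v * indegIn D U v) ≡ 0
  no-arcs = trans (sum-cong-≗ (λ v → cong (λ d → d * d) (indegIn≡0 v))) (trans (sum-const n 0) (*-zeroʳ n))
indeg-bound {n} (suc (suc (suc t))) D _ fr =
  subst₂ _≤_ (sym (cong₂ _*_ (^2≡* (2 + t)) (Σv-indeg²≡∑indegIn² D)))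
             (sym (cong₂ _*_ (^2≡* (1 + t)) (^3≡* n)))
             (∑indegIn²-bound D t (fr ∘ proj₁))

lemma3p1 : (r n : ℕ) → 2 ≤ r → (D : Digraph n) → TT-free r D →
    (r ∸ 1) ^ 2 * (Σv (λ v → outdeg D v ^ 2) ⊔ Σv (λ v → indeg D v ^ 2)) ≤ (r ∸ 2) ^ 2 * n ^ 3
lemma3p1 r n 2≤r D fr = begin
  (r ∸ 1) ^ 2 * (Σout ⊔ Σin)              ≡⟨ *-distribˡ-⊔ ((r ∸ 1) ^ 2) Σout Σin ⟩
  (r ∸ 1) ^ 2 * Σout ⊔ (r ∸ 1) ^ 2 * Σin  ≤⟨ ⊔-lub (indeg-bound r (reverse D) 2≤r (fr ∘ reverse-ContainsTT D))
                                                   (indeg-bound r D 2≤r fr) ⟩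
  (r ∸ 2) ^ 2 * n ^ 3                     ∎
  where
  open ≤-Reasoning
  -- outdeg D and indeg (reverse D) coincide definitionally.
  Σout = Σv (λ v → outdeg D v ^ 2)
  Σin = Σv (λ v → indeg D v ^ 2)
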